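{- Let $G$ be a connected graph with $\mu_d(G)=1$, and let $x\in V(G)$ be such that $\{x\}$ is a dual mutual-visibility set of $G$. Then $\mu_t(G-x)=0$.
   Context: All graphs are finite, simple and connected; $G-x$ is the graph obtained by deleting $x$ and its incident edges. For a connected graph $G$ and $X\subseteq V(G)$, two vertices $u,v$ are $X$-visible if there is a shortest $u,v$-path $P$ in $G$ with $V(P)\cap X\subseteq\{u,v\}$. $X$ is a dual mutual-visibility set if all $u,v$ with $u,v\in X$ or $u,v\in V(G)\setminus X$ are $X$-visible; a total mutual-visibility set if all $u,v\in V(G)$ are $X$-visible. $\mu_d(G)$ and $\mu_t(G)$ denote the maximum cardinalities of such sets, respectively (the empty set is allowed). -}

module Defs where

open import Data.Nat using (ℕ; zero; suc; _≤_)
open import Data.Fin using (Fin; punchIn)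
open import Data.Fin.Subset using (Subset; _∈_; _∉_; ∣_∣)
open import Data.List using (List; []; _∷_)
open import Data.List.Membership.Propositional using () renaming (_∈_ to _∈ₗ_)
open import Data.Product using (Σ; ∃; _×_; _,_)
open import Data.Sum using (_⊎_)
open import Relation.Nullary using (¬_)
open import Relation.Binary.PropositionalEquality using (_≡_)

record Graph (n : ℕ) : Set₁ where
  field
    Adj     : Fin n → Fin n → Set
    sym     : ∀ {u v} → Adj u v → Adj v u
    irrefl  : ∀ {u} → ¬ Adj u u
open Graph public

data Walk {n : ℕ} (G : Graph n) : Fin n → Fin n → ℕ → Set where
  []  : ∀ {u} → Walk G u u 0
  _∷_ : ∀ {u w v k} → Adj G u w → Walk G w v k → Walk G u v (suc k)

verts : ∀ {n} {G : Graph n} {u v k} → Walk G u v k → List (Fin n)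
verts ([] {u})      = u ∷ []
verts (_∷_ {u} _ p) = u ∷ verts p

Connected : ∀ {n} → Graph n → Set
Connected G = ∀ u v → ∃ λ k → Walk G u v k

-- A shortest u,v-path: a u,v-walk of minimum length (necessarily a path).
IsShortest : ∀ {n} {G : Graph n} {u v k} → Walk G u v k → Set
IsShortest {G = G} {u} {v} {k} _ = ∀ k' → Walk G u v k' → k ≤ k'

Visible : ∀ {n} → Graph n → Subset n → Fin n → Fin n → Set
Visible G X u v =
  Σ ℕ λ k → Σ (Walk G u v k) λ P →
    IsShortest P × (∀ w → w ∈ₗ verts P → w ∈ X → (w ≡ u ⊎ w ≡ v))

IsDualMV : ∀ {n} → Graph n → Subset n → Set
IsDualMV G X = ∀ u v → ((u ∈ X × v ∈ X) ⊎ (u ∉ X × v ∉ X)) → Visible G X u v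

IsTotalMV : ∀ {n} → Graph n → Subset n → Set
IsTotalMV G X = ∀ u v → Visible G X u v

IsMaxCard : ∀ {n} → (Subset n → Set) → ℕ → Set
IsMaxCard {n} P k = (Σ (Subset n) λ S → P S × ∣ S ∣ ≡ k) × (∀ S → P S → ∣ S ∣ ≤ k)

-- G - x, with vertices of G - x indexed by Fin m via punchIn x.
_─_ : ∀ {m} → Graph (suc m) → Fin (suc m) → Graph m
G ─ x = record
  { Adj    = λ i j → Adj G (punchIn x i) (punchIn x j)
  ; sym    = sym G
  ; irrefl = irrefl G
  }

-- Deleting x from G preserves distances between the remaining vertices, because the
-- dual visibility of {x} provides, for all u, v ≠ x, a shortest u,v-path of G avoiding x.
-- Hence the empty set is total mutual-visibility in G - x.  Conversely, if some w lies in
-- a total mutual-visibility set of G - x, then every pair of vertices of G - x is joined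
-- by a shortest path of G meeting {x, w} at most in its endpoints, so {x, w} is a dual
-- mutual-visibility set of G of size 2, contradicting μ_d(G) = 1.
module Submission where

open import Defs
open import Data.Nat using (ℕ; suc; _≤_; _<_; z≤n; _≤?_)
open import Data.Nat.Properties using (≤-trans; ≤-reflexive; ≰⇒>; 1+n≰n)
open import Data.Nat.Induction using (<-rec)
open import Data.Fin using (Fin; punchIn; punchOut)
open import Data.Fin.Properties using (punchIn-injective; punchInᵢ≢i; punchIn-punchOut)
open import Data.Fin.Subset using (⁅_⁆; _∪_; _∈_; _∉_; ∣_∣; Empty; ⊥)
open import Data.Fin.Subset.Properties
  using (x∈⁅x⁆; x∈⁅y⁆⇒x≡y; x≢y⇒x∉⁅y⁆; ∉⊥; ∣⊥∣≡0; Empty-unique; x∈p∪q⁻; x∈p∪q⁺; p⊆p∪q; p⊂q⇒∣p∣<∣q∣; ∣⁅x⁆∣≡1)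
open import Data.List using (map; _∷_)
open import Data.List.Membership.Propositional using () renaming (_∈_ to _∈ₗ_)
open import Data.List.Membership.Propositional.Properties using (∈-map⁻)
open import Data.List.Relation.Unary.Any using (here; there)
open import Data.Product using (Σ; _×_; _,_)
open import Data.Sum using (_⊎_; inj₁; inj₂; swap)
open import Data.Empty using () renaming (⊥ to False; ⊥-elim to False-elim)
open import Relation.Nullary using (¬_; yes; no)
open import Relation.Binary.PropositionalEquality
  using (_≡_; _≢_; refl; trans; cong; subst; subst₂; ≢-sym)
  renaming (sym to ≡-sym)

¬¬-least : (P : ℕ → Set) → ∀ k → P k → ¬ ¬ (Σ ℕ λ j → P j × (∀ i → P i → j ≤ i))
¬¬-least P k pk no-least = <-rec (λ j → ¬ P j) below-least k pk
  where
  below-least : ∀ j → (∀ {i} → i < j → ¬ P i) → ¬ P j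
  below-least j ih pj = no-least (j , pj , least)
    where
    least : ∀ i → P i → j ≤ i
    least i pi with j ≤? i
    ... | yes j≤i = j≤i
    ... | no j≰i = False-elim (ih (≰⇒> j≰i) pi)

ShortestWalk : ∀ {n} → Graph n → Fin n → Fin n → Set
ShortestWalk G a b = Σ ℕ λ k → Σ (Walk G a b k) IsShortest

module _ {n} {G : Graph n} where

  head∈verts : ∀ {a b k} (P : Walk G a b k) → a ∈ₗ verts P
  head∈verts []      = here refl
  head∈verts (_ ∷ _) = here refl

  snoc : ∀ {a b c k} → Walk G a b k → Adj G b c → Walk G a c (suc k)
  snoc []      e = e ∷ []
  snoc (d ∷ P) e = d ∷ snoc P e

  reverse : ∀ {a b k} → Walk G a b k → Walk G b a k
  reverse []      = []
  reverse (e ∷ P) = snoc (reverse P) (sym G e)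

  shortestWalk-reverse : ∀ {a b} → ShortestWalk G a b → ShortestWalk G b a
  shortestWalk-reverse (k , P , shortest) =
    k , reverse P , λ k' W → shortest k' (reverse W)

  ¬¬-shortestWalk : Connected G → ∀ a b → ¬ ¬ ShortestWalk G a b
  ¬¬-shortestWalk conn a b none =
    let k , W = conn a b in
    ¬¬-least (Walk G a b) k W λ { (j , P , least) → none (j , P , least) }

  visible-refl : ∀ X a → Visible G X a a
  visible-refl X a = 0 , [] , (λ _ _ → z≤n) , λ { _ (here z≡a) _ → inj₁ z≡a ; _ (there ()) _ }

  shortestWalk⇒visible : ∀ {X a b} → (∀ z → z ∈ X → z ≡ a ⊎ z ≡ b) →
                         ShortestWalk G a b → Visible G X a b
  shortestWalk⇒visible X⊆ab (k , P , shortest) = k , P , shortest , λ z _ → X⊆ab z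

∈⁅x⁆∪⁅y⁆⁻ : ∀ {n} {x y z : Fin n} → z ∈ ⁅ x ⁆ ∪ ⁅ y ⁆ → z ≡ x ⊎ z ≡ y
∈⁅x⁆∪⁅y⁆⁻ {x = x} {y} z∈ with x∈p∪q⁻ ⁅ x ⁆ ⁅ y ⁆ z∈
... | inj₁ z∈⁅x⁆ = inj₁ (x∈⁅y⁆⇒x≡y x z∈⁅x⁆)
... | inj₂ z∈⁅y⁆ = inj₂ (x∈⁅y⁆⇒x≡y y z∈⁅y⁆)

x≢y⇒2≤∣⁅x⁆∪⁅y⁆∣ : ∀ {n} {x y : Fin n} → x ≢ y → 2 ≤ ∣ ⁅ x ⁆ ∪ ⁅ y ⁆ ∣
x≢y⇒2≤∣⁅x⁆∪⁅y⁆∣ {x = x} {y} x≢y =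
  subst (λ c → suc c ≤ ∣ ⁅ x ⁆ ∪ ⁅ y ⁆ ∣) (∣⁅x⁆∣≡1 x)
    (p⊂q⇒∣p∣<∣q∣ (p⊆p∪q ⁅ y ⁆ , y , x∈p∪q⁺ (inj₂ (x∈⁅x⁆ y)) , x≢y⇒x∉⁅y⁆ (≢-sym x≢y)))

module Deletion {m} (G : Graph (suc m)) (x : Fin (suc m)) where

  lift : ∀ {u v k} → Walk (G ─ x) u v k → Walk G (punchIn x u) (punchIn x v) k
  lift []      = []
  lift (e ∷ P) = e ∷ lift P

  verts-lift : ∀ {u v k} (P : Walk (G ─ x) u v k) → verts (lift P) ≡ map (punchIn x) (verts P)
  verts-lift []      = refl
  verts-lift (_ ∷ P) = cong (_ ∷_) (verts-lift P)

  lower : ∀ {a b k} (P : Walk G a b k) → (∀ z → z ∈ₗ verts P → z ≢ x) →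
          ∀ u v → a ≡ punchIn x u → b ≡ punchIn x v → Walk (G ─ x) u v k
  lower [] _ u v a≡u b≡v =
    subst (λ t → Walk (G ─ x) u t 0) (punchIn-injective x u v (trans (≡-sym a≡u) b≡v)) []
  lower (_∷_ {w = c} e P) avoids u v a≡u b≡v =
    subst₂ (Adj G) a≡u c≡c' e ∷ lower P (λ z z∈ → avoids z (there z∈)) (punchOut x≢c) v c≡c' b≡v
    where
    x≢c : x ≢ c
    x≢c x≡c = avoids c (there (head∈verts P)) (≡-sym x≡c)
    c≡c' : c ≡ punchIn x (punchOut x≢c)
    c≡c' = ≡-sym (punchIn-punchOut x≢c)

  ≢x⇒punchIn : ∀ {z} → z ≢ x → Σ (Fin m) λ a → z ≡ punchIn x a
  ≢x⇒punchIn z≢x = punchOut (≢-sym z≢x) , ≡-sym (punchIn-punchOut (≢-sym z≢x))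

  ∉⇒≢x : ∀ {X z} → z ∉ ⁅ x ⁆ ∪ X → z ≢ x
  ∉⇒≢x z∉ refl = z∉ (x∈p∪q⁺ (inj₁ (x∈⁅x⁆ x)))

  punchIn∉⁅x⁆ : ∀ u → punchIn x u ∉ ⁅ x ⁆
  punchIn∉⁅x⁆ u = x≢y⇒x∉⁅y⁆ (punchInᵢ≢i x u)

  module _ (⁅x⁆-dual : IsDualMV G ⁅ x ⁆) where

    deletion-shortcut : ∀ u v → Σ ℕ λ k → Σ (Walk (G ─ x) u v k) λ _ →
                          ∀ k' → Walk G (punchIn x u) (punchIn x v) k' → k ≤ k'
    deletion-shortcut u v with ⁅x⁆-dual (punchIn x u) (punchIn x v) (inj₂ (punchIn∉⁅x⁆ u , punchIn∉⁅x⁆ v))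
    ... | k , P , shortest , meets = k , lower P avoids u v refl refl , shortest
      where
      avoids : ∀ z → z ∈ₗ verts P → z ≢ x
      avoids z z∈ z≡x with meets z z∈ (subst (_∈ ⁅ x ⁆) (≡-sym z≡x) (x∈⁅x⁆ x))
      ... | inj₁ z≡u = punchInᵢ≢i x u (trans (≡-sym z≡u) z≡x)
      ... | inj₂ z≡v = punchInᵢ≢i x v (trans (≡-sym z≡v) z≡x)

    lift-shortest : ∀ {u v k} {P : Walk (G ─ x) u v k} → IsShortest P → IsShortest (lift P)
    lift-shortest {u} {v} shortest k' W with deletion-shortcut u v
    ... | j , Q , Q≤ = ≤-trans (shortest j Q) (Q≤ k' W)

    ⊥-isTotalMV : IsTotalMV (G ─ x) ⊥
    ⊥-isTotalMV u v with deletion-shortcut u v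
    ... | k , P , P≤ = k , P , (λ k' W → P≤ k' (lift W)) , λ _ _ z∈⊥ → False-elim (∉⊥ z∈⊥)

    visible-lift : ∀ {S X u v} → (∀ a → punchIn x a ∈ X → a ∈ S) →
                   Visible (G ─ x) S u v → Visible G X (punchIn x u) (punchIn x v)
    visible-lift {S} {X} {u} {v} X⊆S (k , P , shortest , meets) =
      k , lift P , lift-shortest {P = P} shortest , meets-lift
      where
      meets-lift : ∀ z → z ∈ₗ verts (lift P) → z ∈ X → z ≡ punchIn x u ⊎ z ≡ punchIn x v
      meets-lift z z∈ z∈X with ∈-map⁻ (punchIn x) (subst (z ∈ₗ_) (verts-lift P) z∈)
      ... | a , a∈ , refl with meets a a∈ (X⊆S a z∈X)
      ...   | inj₁ a≡u = inj₁ (cong (punchIn x) a≡u)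
      ...   | inj₂ a≡v = inj₂ (cong (punchIn x) a≡v)

    pair-isDualMV : ∀ {S w} → IsTotalMV (G ─ x) S → w ∈ S → ShortestWalk G x (punchIn x w) →
                    IsDualMV G (⁅ x ⁆ ∪ ⁅ punchIn x w ⁆)
    pair-isDualMV {S} {w} S-total w∈S xy u v (inj₂ (u∉ , v∉))
      with ≢x⇒punchIn (∉⇒≢x u∉) | ≢x⇒punchIn (∉⇒≢x v∉)
    ... | _ , refl | _ , refl = visible-lift preimage⊆S (S-total _ _)
      where
      preimage⊆S : ∀ a → punchIn x a ∈ ⁅ x ⁆ ∪ ⁅ punchIn x w ⁆ → a ∈ S
      preimage⊆S a a∈ with ∈⁅x⁆∪⁅y⁆⁻ a∈
      ... | inj₁ a≡x = False-elim (punchInᵢ≢i x a a≡x)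
      ... | inj₂ a≡w = subst (_∈ S) (≡-sym (punchIn-injective x a w a≡w)) w∈S
    pair-isDualMV S-total w∈S xy u v (inj₁ (u∈ , v∈)) with ∈⁅x⁆∪⁅y⁆⁻ u∈ | ∈⁅x⁆∪⁅y⁆⁻ v∈
    ... | inj₁ refl | inj₁ refl = visible-refl _ _
    ... | inj₂ refl | inj₂ refl = visible-refl _ _
    ... | inj₁ refl | inj₂ refl = shortestWalk⇒visible (λ _ → ∈⁅x⁆∪⁅y⁆⁻) xy
    ... | inj₂ refl | inj₁ refl =
      shortestWalk⇒visible (λ _ z∈ → swap (∈⁅x⁆∪⁅y⁆⁻ z∈)) (shortestWalk-reverse xy)

lemma2p5 : ∀ {m} (G : Graph (suc m)) → Connected G → IsMaxCard (IsDualMV G) 1 →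
             (x : Fin (suc m)) → IsDualMV G ⁅ x ⁆ → IsMaxCard (IsTotalMV (G ─ x)) 0
lemma2p5 {m} G conn (_ , dual≤1) x ⁅x⁆-dual = (⊥ , ⊥-isTotalMV ⁅x⁆-dual , ∣⊥∣≡0 m) , total≤0
  where
  open Deletion G x
  total≤0 : ∀ S → IsTotalMV (G ─ x) S → ∣ S ∣ ≤ 0
  total≤0 S S-total = ≤-reflexive (trans (cong ∣_∣ (Empty-unique S-empty)) (∣⊥∣≡0 m))
    where
    S-empty : Empty S
    S-empty (w , w∈S) = ¬¬-shortestWalk conn x (punchIn x w) λ xy →
      1+n≰n (≤-trans (x≢y⇒2≤∣⁅x⁆∪⁅y⁆∣ (≢-sym (punchInᵢ≢i x w)))
                   (dual≤1 _ (pair-isDualMV ⁅x⁆-dual S-total w∈S xy)))
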